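{- Let $\mathcal T=\{t_0,t_1,\dots,t_{k-1}\}\subseteq\{0,1,\dots,n-1\}$ with the $t_i$ pairwise distinct, and let $\mathcal C_{\mathcal T}=\{a_0X^{q^{t_0}}+\dots+a_{k-1}X^{q^{t_{k-1}}}: a_0,\dots,a_{k-1}\in\mathbb F_{q^n}\}$. If $\mathcal C_{\mathcal T}$ is an MRD code, then $\gcd(t_i-t_j,n)<k$ for all $i\neq j$ in $\{0,\dots,k-1\}$.
   Context: Let $q$ be a prime power and $n$ a positive integer. A $q$-polynomial over $\mathbb F_{q^n}$ defines an $\mathbb F_q$-linear map of $\mathbb F_{q^n}$; fixing an $\mathbb F_q$-basis, sets of such polynomials are rank-metric codes in $\mathbb F_q^{n\times n}$ with distance $\mathrm{rank}(A-B)$. A code of minimum distance $d$ is MRD if its size is $q^{n(n-d+1)}$. -}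

module Defs where

open import Level using (Level)
open import Algebra.Bundles using (CommutativeRing)
open import Data.Nat as ℕ using (ℕ; zero; suc; _<_; _≤_)
open import Data.Nat.Primality using (Prime)
open import Data.Fin using (Fin)
open import Data.List as List using (List; []; _∷_; length; deduplicate; concatMap)
open import Data.List.Relation.Unary.Any using (Any)
open import Data.List.Relation.Unary.AllPairs using (AllPairs)
open import Data.List.Relation.Binary.Pointwise as PW using (Pointwise)
open import Data.Product using (Σ; ∃; ∃-syntax; _×_; _,_)
open import Relation.Binary.Definitions using (Decidable)
open import Relation.Nullary using (¬_)
open import Relation.Binary.PropositionalEquality using (_≡_)

IsPrimePower : ℕ → Set
IsPrimePower q = ∃[ p ] ∃[ m ] (Prime p × q ≡ p ℕ.^ suc m)

record FiniteField (c ℓ : Level) : Set (Level.suc (c Level.⊔ ℓ)) where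
  field
    commRing  : CommutativeRing c ℓ
  open CommutativeRing commRing public
  field
    _≟_       : Decidable _≈_
    1≉0       : ¬ (1# ≈ 0#)
    inverse   : ∀ x → ¬ (x ≈ 0#) → ∃[ y ] (x * y ≈ 1#)
    elems     : List Carrier
    complete  : ∀ x → Any (x ≈_) elems
    unique    : AllPairs (λ x y → ¬ (x ≈ y)) elems

  card : ℕ
  card = length elems

  _^_ : Carrier → ℕ → Carrier
  x ^ zero  = 1#
  x ^ suc m = x * (x ^ m)

  sumFin : ∀ k → (Fin k → Carrier) → Carrier
  sumFin zero    f = 0#
  sumFin (suc k) f = f Fin.zero + sumFin k (λ i → f (Fin.suc i))

  qPoly : (q : ℕ) → ∀ {k} → (Fin k → ℕ) → (Fin k → Carrier) → Carrier → Carrier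
  qPoly q {k} t a x = sumFin k (λ i → a i * (x ^ (q ℕ.^ t i)))

  imageSize : (Carrier → Carrier) → ℕ
  imageSize f = length (deduplicate _≟_ (List.map f elems))

  -- the F_q-linear map f has rank r  (its image is an F_q-space of
  -- dimension r, i.e. has q^r elements)
  HasRank : (q : ℕ) → (Carrier → Carrier) → ℕ → Set
  HasRank q f r = imageSize f ≡ q ℕ.^ r

  SameMap : (Carrier → Carrier) → (Carrier → Carrier) → Set (c Level.⊔ ℓ)
  SameMap f g = ∀ x → f x ≈ g x

  allCoeffs : ∀ k → List (Fin k → Carrier)
  allCoeffs zero    = (λ ()) ∷ []
  allCoeffs (suc k) =
    concatMap (λ x → List.map (λ a → λ where Fin.zero → x ; (Fin.suc i) → a i)
                              (allCoeffs k))
              elems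

  table : (Carrier → Carrier) → List Carrier
  table f = List.map f elems

  codeSize : (q : ℕ) → ∀ {k} → (Fin k → ℕ) → ℕ
  codeSize q {k} t =
    length (deduplicate (PW.decidable _≟_)
                        (List.map (λ a → table (qPoly q t a)) (allCoeffs k)))

  MinDistance : (q : ℕ) → ∀ {k} → (Fin k → ℕ) → ℕ → Set (c Level.⊔ ℓ)
  MinDistance q {k} t d =
    (∃[ a ] ∃[ b ] (¬ SameMap (qPoly q t a) (qPoly q t b)
                    × HasRank q (λ x → qPoly q t a x - qPoly q t b x) d))
    × (∀ a b → ¬ SameMap (qPoly q t a) (qPoly q t b) →
         ∀ r → HasRank q (λ x → qPoly q t a x - qPoly q t b x) r → d ≤ r)

  -- C_T is an MRD code (over F_q, in F_q^{n×n})
  IsMRD : (q n : ℕ) → ∀ {k} → (Fin k → ℕ) → Set (c Level.⊔ ℓ)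
  IsMRD q n t = ∃[ d ] (MinDistance q t d × codeSize q t ≡ q ℕ.^ (n ℕ.* (n ℕ.∸ d ℕ.+ 1)))

{-# OPTIONS --safe #-}
-- The codeword x ↦ x^(q^a) - x^(q^b), with a = tᵢ and b = tⱼ, is additive (L has characteristic p,
-- so Frobenius is additive), and its kernel {x | x^(q^a) = x^(q^b)} is the subfield {x | x^(q^g) = x}
-- with g = gcd(|a - b|, n): the exponents e with x^(q^e) = x are closed under addition and, Frobenius
-- being injective, under cancellation; they contain n by Fermat, hence g by Bézout. This subfield has
-- exactly Q = q^g elements: X^Q - X has at most Q roots, and with card = 1 + (t+1)(Q-1) every other
-- element is a root of 1 + X^(Q-1) + … + X^(t(Q-1)). By rank-nullity the codeword has rank n - g, so
-- the minimum distance d is at most n - g. On the other hand C_T has at most q^(nk) elements, so the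
-- MRD size q^(n(n-d+1)) forces n - d + 1 ≤ k, whence g ≤ n - d < k.
module Submission where

open import Defs
open import Level using (Level; _⊔_)
open import Data.Nat as ℕ using (ℕ; zero; suc; _∸_; _≤_; _<_; z≤n; s≤s; ∣_-_∣; NonZero)
import Data.Nat.Properties as ℕ
open import Data.Fin as Fin using (Fin; toℕ; fromℕ; inject₁)
open import Data.List as List using (List; []; _∷_; length; map; filter; foldr; deduplicate)
open import Data.List.Relation.Unary.All as All using (All; []; _∷_)
open import Data.List.Relation.Unary.Any as Any using (Any; here; there)
open import Data.List.Relation.Unary.AllPairs using ([]; _∷_)
open import Data.Product using (∃-syntax; _,_; proj₂)
open import Data.Sum using (_⊎_; inj₁; inj₂; [_,_]′)
open import Data.Empty using (⊥-elim)
open import Data.Unit using (⊤; tt)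
open import Function using (id; _∘_; _⇔_; mk⇔; Equivalence)
open import Relation.Nullary using (¬_; Dec; yes; no; ¬?)
open import Relation.Unary using (Pred; Decidable; _⊆_)
open import Relation.Binary.Bundles using (Setoid; DecSetoid)
open import Relation.Binary.Core using (_Preserves_⟶_)
open import Relation.Binary.PropositionalEquality as ≡ using (_≡_; _≢_)
import Relation.Binary.Definitions
import Relation.Binary.Reasoning.Setoid

module Counting where

  open import Data.Nat using (_+_; _*_)
  open import Data.Nat.Properties
    using (+-mono-≤; ≤-trans; ≤-reflexive; ≤-refl; ≤-antisym; *-zeroʳ; *-identityʳ; +-commutativeSemigroup)
  open import Data.Nat.ListAction using (sum)
  open import Data.List.Properties using (map-∘; length-++)
  open import Algebra.Properties.CommutativeSemigroup +-commutativeSemigroup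
    using () renaming (interchange to +-interchange)

  private
    variable
      a b p q r : Level
      A B : Set a

  length-concatMap-const : ∀ {f : A → List B} {c} →
                           (∀ x → length (f x) ≡ c) → ∀ xs → length (List.concatMap f xs) ≡ length xs * c
  length-concatMap-const         |f|≡c []       = ≡.refl
  length-concatMap-const {f = f} |f|≡c (x ∷ xs) =
    ≡.trans (length-++ (f x)) (≡.cong₂ _+_ (|f|≡c x) (length-concatMap-const |f|≡c xs))

  ∑ : List A → (A → ℕ) → ℕ
  ∑ xs f = sum (map f xs)

  ∑-cong : ∀ {f g : A → ℕ} xs → All (λ x → f x ≡ g x) xs → ∑ xs f ≡ ∑ xs g
  ∑-cong []       []       = ≡.refl
  ∑-cong (x ∷ xs) (e ∷ es) = ≡.cong₂ _+_ e (∑-cong xs es)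

  ∑-mono : ∀ {f g : A → ℕ} xs → (∀ x → f x ≤ g x) → ∑ xs f ≤ ∑ xs g
  ∑-mono []       _   = z≤n
  ∑-mono (x ∷ xs) f≤g = +-mono-≤ (f≤g x) (∑-mono xs f≤g)

  ∑-+ : ∀ (f g : A → ℕ) xs → ∑ xs (λ x → f x + g x) ≡ ∑ xs f + ∑ xs g
  ∑-+ f g []       = ≡.refl
  ∑-+ f g (x ∷ xs) = ≡.trans (≡.cong (f x + g x +_) (∑-+ f g xs))
                             (+-interchange (f x) (g x) (∑ xs f) (∑ xs g))

  ∑-map : ∀ (h : B → A) (f : A → ℕ) xs → ∑ (map h xs) f ≡ ∑ xs (f ∘ h)
  ∑-map h f xs = ≡.cong sum (≡.sym (map-∘ xs))

  ∑-const : ∀ (c : ℕ) (xs : List A) → ∑ xs (λ _ → c) ≡ length xs * c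
  ∑-const c []       = ≡.refl
  ∑-const c (x ∷ xs) = ≡.cong (c +_) (∑-const c xs)

  ∑-comm : ∀ (f : A → B → ℕ) xs ys →
           ∑ xs (λ x → ∑ ys (f x)) ≡ ∑ ys (λ y → ∑ xs (λ x → f x y))
  ∑-comm f []       ys = ≡.sym (≡.trans (∑-const 0 ys) (*-zeroʳ (length ys)))
  ∑-comm f (x ∷ xs) ys = ≡.trans (≡.cong (∑ ys (f x) +_) (∑-comm f xs ys)) (≡.sym (∑-+ (f x) _ ys))

  𝟙 : {P : Set p} → Dec P → ℕ
  𝟙 (yes _) = 1
  𝟙 (no _)  = 0

  𝟙-mono : {P : Set p} {Q : Set q} → (P → Q) → (P? : Dec P) (Q? : Dec Q) → 𝟙 P? ≤ 𝟙 Q?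
  𝟙-mono P⇒Q (no _)  _       = z≤n
  𝟙-mono P⇒Q (yes _) (yes _) = ≤-refl
  𝟙-mono P⇒Q (yes p) (no ¬q) = ⊥-elim (¬q (P⇒Q p))

  𝟙-cong : {P : Set p} {Q : Set q} → (P → Q) → (Q → P) → (P? : Dec P) (Q? : Dec Q) → 𝟙 P? ≡ 𝟙 Q?
  𝟙-cong P⇒Q Q⇒P P? Q? = ≤-antisym (𝟙-mono P⇒Q P? Q?) (𝟙-mono Q⇒P Q? P?)

  count : {P : Pred A p} → Decidable P → List A → ℕ
  count P? xs = ∑ xs (𝟙 ∘ P?)

  module _ {P : Pred A p} {Q : Pred A q} (P? : Decidable P) (Q? : Decidable Q) where

    count-⊆ : P ⊆ Q → ∀ xs → count P? xs ≤ count Q? xs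
    count-⊆ P⊆Q xs = ∑-mono xs (λ x → 𝟙-mono P⊆Q (P? x) (Q? x))

    count-≐ : P ⊆ Q → Q ⊆ P → ∀ xs → count P? xs ≡ count Q? xs
    count-≐ P⊆Q Q⊆P xs = ∑-cong xs (All.universal (λ x → 𝟙-cong P⊆Q Q⊆P (P? x) (Q? x)) xs)

  module _ {P : Pred A p} {Q : Pred A q} {R : Pred A r}
           (P? : Decidable P) (Q? : Decidable Q) (R? : Decidable R) where

    count-⊆-∪ : (∀ {x} → P x → Q x ⊎ R x) → ∀ xs → count P? xs ≤ count Q? xs + count R? xs
    count-⊆-∪ P⊆Q∪R xs = ≤-trans (∑-mono xs 𝟙-⊆-∪) (≤-reflexive (∑-+ (𝟙 ∘ Q?) (𝟙 ∘ R?) xs))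
      where
      𝟙-⊆-∪ : ∀ x → 𝟙 (P? x) ≤ 𝟙 (Q? x) + 𝟙 (R? x)
      𝟙-⊆-∪ x with P? x | Q? x | R? x
      ... | no _   | _     | _     = z≤n
      ... | yes _  | yes _ | _     = s≤s z≤n
      ... | yes _  | no _  | yes _ = s≤s z≤n
      ... | yes px | no ¬q | no ¬r = ⊥-elim ([ ¬q , ¬r ]′ (P⊆Q∪R px))

  module _ {P : Pred A p} (P? : Decidable P) where

    count-all : ∀ {xs} → All P xs → count P? xs ≡ length xs
    count-all {[]}     []         = ≡.refl
    count-all {x ∷ xs} (px ∷ pxs) with P? x
    ... | yes _ = ≡.cong suc (count-all pxs)
    ... | no ¬p = ⊥-elim (¬p px)

    count-none : ∀ {xs} → All (¬_ ∘ P) xs → count P? xs ≡ 0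
    count-none {[]}     []           = ≡.refl
    count-none {x ∷ xs} (¬px ∷ ¬pxs) with P? x
    ... | yes px = ⊥-elim (¬px px)
    ... | no _   = count-none ¬pxs

    count≡length-filter : ∀ xs → count P? xs ≡ length (filter P? xs)
    count≡length-filter []       = ≡.refl
    count≡length-filter (x ∷ xs) with P? x
    ... | yes _ = ≡.cong suc (count≡length-filter xs)
    ... | no _  = count≡length-filter xs

    count+count-¬≡length : ∀ xs → count P? xs + count (¬? ∘ P?) xs ≡ length xs
    count+count-¬≡length xs = begin
      count P? xs + count (¬? ∘ P?) xs        ≡⟨ ∑-+ (𝟙 ∘ P?) (𝟙 ∘ ¬? ∘ P?) xs ⟨
      ∑ xs (λ x → 𝟙 (P? x) + 𝟙 (¬? (P? x)))  ≡⟨ ∑-cong xs (All.universal (𝟙+𝟙-¬≡1 ∘ P?) xs) ⟩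
      ∑ xs (λ _ → 1)                          ≡⟨ ∑-const 1 xs ⟩
      length xs * 1                           ≡⟨ *-identityʳ (length xs) ⟩
      length xs                               ∎
      where
      open ≡.≡-Reasoning
      𝟙+𝟙-¬≡1 : {P : Set p} (P? : Dec P) → 𝟙 P? + 𝟙 (¬? P?) ≡ 1
      𝟙+𝟙-¬≡1 (yes _) = ≡.refl
      𝟙+𝟙-¬≡1 (no _)  = ≡.refl

module UniqueLists {a ℓ} (S : Setoid a ℓ) where

  open Setoid S renaming (Carrier to A)
  open Counting
  open import Data.List using (_++_)
  open import Data.Product using (_×_)
  open import Data.Nat.Properties using (+-0-isCommutativeMonoid)
  open import Data.List.Membership.Setoid S using (_∈_)
  open import Data.List.Membership.Setoid.Properties using (∈-∃++; ∈-resp-≈; ∈-map⁺; ∈-map⁻)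
  open import Data.List.Relation.Unary.Unique.Setoid S using (Unique; head; tail)
  import Data.List.Relation.Unary.Unique.Setoid.Properties as Unique
  open import Data.List.Relation.Binary.Permutation.Setoid S
    using (_↭_; prep; ↭-refl; ↭-trans; ↭-sym; ↭-reflexive-≋)
  open import Data.List.Relation.Binary.Permutation.Setoid.Properties S
    using (shift; map⁺; Unique-resp-↭; ∈-resp-↭)
  open import Relation.Binary.PropositionalEquality.Properties using () renaming (setoid to ≡-setoid)
  import Data.List.Relation.Binary.Permutation.Setoid.Properties (≡-setoid ℕ) as ℕ↭

  ∑-↭ : ∀ {f : A → ℕ} → f Preserves _≈_ ⟶ _≡_ → ∀ {xs ys} → xs ↭ ys → ∑ xs f ≡ ∑ ys f
  ∑-↭ f-cong xs↭ys = ℕ↭.foldr-commMonoid +-0-isCommutativeMonoid (map⁺ (≡-setoid ℕ) f-cong xs↭ys)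

  All≉∧∈⇒≉ : ∀ {x y xs} → All (x ≉_) xs → y ∈ xs → x ≉ y
  All≉∧∈⇒≉ x≉xs = All.lookupₛ S (λ y≈z x≉y x≈z → x≉y (trans x≈z (sym y≈z))) x≉xs

  unique-↭ : ∀ {xs ys} → Unique xs → Unique ys →
             (∀ {z} → z ∈ xs → z ∈ ys) → (∀ {z} → z ∈ ys → z ∈ xs) → xs ↭ ys
  unique-↭ {[]}     {[]}    _ _ _ _ = ↭-refl
  unique-↭ {[]}     {_ ∷ _} _ _ _ ys⊆xs with () ← ys⊆xs (here refl)
  unique-↭ {x ∷ xs} {ys} (x≉xs ∷ xs!) ys! xs⊆ys ys⊆xs with ∈-∃++ S (xs⊆ys (here refl))
  ... | as , bs , w , x≈w , ys≋ = ↭-trans (prep x≈w xs↭as++bs) (↭-sym ys↭w∷as++bs)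
    where
    ys↭w∷as++bs : ys ↭ w ∷ (as ++ bs)
    ys↭w∷as++bs = ↭-trans (↭-reflexive-≋ ys≋) (shift refl as bs)
    w∷as++bs! : Unique (w ∷ (as ++ bs))
    w∷as++bs! = Unique-resp-↭ ys↭w∷as++bs ys!
    xs⊆as++bs : ∀ {z} → z ∈ xs → z ∈ as ++ bs
    xs⊆as++bs z∈xs with ∈-resp-↭ ys↭w∷as++bs (xs⊆ys (there z∈xs))
    ... | here z≈w = ⊥-elim (All≉∧∈⇒≉ x≉xs z∈xs (trans x≈w (sym z≈w)))
    ... | there z∈ = z∈
    as++bs⊆xs : ∀ {z} → z ∈ as ++ bs → z ∈ xs
    as++bs⊆xs z∈ with ys⊆xs (∈-resp-↭ (↭-sym ys↭w∷as++bs) (there z∈))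
    ... | here z≈x   = ⊥-elim (All≉∧∈⇒≉ (head w∷as++bs!) z∈ (trans (sym x≈w) (sym z≈x)))
    ... | there z∈xs = z∈xs
    xs↭as++bs : xs ↭ as ++ bs
    xs↭as++bs = unique-↭ xs! (tail w∷as++bs!) xs⊆as++bs as++bs⊆xs

  map-↭ : ∀ (h : A → A) {xs} → Unique xs →
          h Preserves _≈_ ⟶ _≈_ → (∀ {x y} → h x ≈ h y → x ≈ y) →
          (∀ {x} → x ∈ xs → h x ∈ xs) → (∀ {y} → y ∈ xs → ∃[ x ] (x ∈ xs × h x ≈ y)) →
          map h xs ↭ xs
  map-↭ h {xs} xs! h-cong h-injective h-into h-onto =
    unique-↭ (Unique.map⁺ S S h-injective xs!) xs! image⊆xs xs⊆image
    where
    image⊆xs : ∀ {z} → z ∈ map h xs → z ∈ xs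
    image⊆xs z∈ with x , x∈ , z≈hx ← ∈-map⁻ S S z∈ = ∈-resp-≈ S (sym z≈hx) (h-into x∈)
    xs⊆image : ∀ {y} → y ∈ xs → y ∈ map h xs
    xs⊆image y∈ with x , x∈ , hx≈y ← h-onto y∈ = ∈-resp-≈ S hx≈y (∈-map⁺ S S h-cong x∈)

  module _ (_≟_ : Relation.Binary.Definitions.Decidable _≈_) where

    count-unique : ∀ {x xs} → Unique xs → x ∈ xs → count (x ≟_) xs ≡ 1
    count-unique {x} {y ∷ ys} (y≉ys ∷ _) (here x≈y) with x ≟ y
    ... | no x≉y = ⊥-elim (x≉y x≈y)
    ... | yes _  = ≡.cong suc (count-none (x ≟_) (All.map (λ y≉z x≈z → y≉z (trans (sym x≈y) x≈z)) y≉ys))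
    count-unique {x} {y ∷ ys} (y≉ys ∷ ys!) (there x∈ys) with x ≟ y
    ... | yes x≈y = ⊥-elim (All≉∧∈⇒≉ y≉ys x∈ys (sym x≈y))
    ... | no _    = count-unique ys! x∈ys

module Arithmetic where

  open import Data.Nat using (_+_; _*_; _^_; _!)
  open import Data.Nat.Properties
  open import Data.Nat.Divisibility using (_∣_; divides; ∣⇒≤; ∣1⇒≡1; m∣m*n)
  open import Data.Nat.DivMod using (m/n*n≡m)
  open import Data.Nat.GCD using (gcd; gcd[m,n]∣m; gcd-GCD; module Bézout)
  open import Data.Nat.Primality using (Prime; euclidsLemma; prime⇒nonTrivial)
  open import Data.Nat.Combinatorics using (_C_; k![n∸k]!∣n!)
  open import Data.Nat.Combinatorics.Specification using (nCk≡n!/k![n-k]!)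

  prime∤! : ∀ {p m} → Prime p → m < p → ¬ p ∣ m !
  prime∤! {p} {zero}  pr _   p∣1  =
    <⇒≢ (ℕ.nonTrivial⇒n>1 p {{prime⇒nonTrivial pr}}) (≡.sym (∣1⇒≡1 p∣1))
  prime∤! {p} {suc m} pr m<p p∣m! with euclidsLemma (suc m) (m !) pr p∣m!
  ... | inj₁ p∣1+m = <⇒≱ m<p (∣⇒≤ p∣1+m)
  ... | inj₂ p∣m!  = prime∤! pr (<-trans (n<1+n m) m<p) p∣m!

  prime∣C : ∀ {p k} → Prime p → 0 < k → k < p → p ∣ p C k
  prime∣C {p} {k} pr 0<k k<p =
    [ id , ⊥-elim ∘ p∤k!*[p∸k]! ]′ (euclidsLemma (p C k) (k ! * (p ∸ k) !) pr p∣C*k!*[p∸k]!)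
    where
    instance _ = k !* (p ∸ k) !≢0
    n∣n! : ∀ {n} → 0 < n → n ∣ n !
    n∣n! {suc n} _ = m∣m*n (n !)
    C*k!*[p∸k]!≡p! : (p C k) * (k ! * (p ∸ k) !) ≡ p !
    C*k!*[p∸k]!≡p! = ≡.trans (≡.cong (_* (k ! * (p ∸ k) !)) (nCk≡n!/k![n-k]! (<⇒≤ k<p)))
                             (m/n*n≡m (k![n∸k]!∣n! (<⇒≤ k<p)))
    p∣C*k!*[p∸k]! : p ∣ (p C k) * (k ! * (p ∸ k) !)
    p∣C*k!*[p∸k]! = ≡.subst (p ∣_) (≡.sym C*k!*[p∸k]!≡p!) (n∣n! (<-trans 0<k k<p))
    p∤k!*[p∸k]! : ¬ p ∣ k ! * (p ∸ k) !
    p∤k!*[p∸k]! p∣ = [ prime∤! pr k<p , prime∤! pr (∸-monoʳ-< 0<k (<⇒≤ k<p)) ]′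
                       (euclidsLemma (k !) ((p ∸ k) !) pr p∣)

  module _ {ℓ} (P : Pred ℕ ℓ) (+-closed : ∀ a b → P a → P b → P (a + b))
           (∸-closed : ∀ a b → P (a + b) → P b → P a) where

    *-closed : ∀ c {a} → P a → P (c * a)
    *-closed zero    {a} Pa = ∸-closed 0 a Pa Pa
    *-closed (suc c) {a} Pa = +-closed a (c * a) Pa (*-closed c Pa)

    ∣-closed : ∀ {a b} → a ∣ b → P a → P b
    ∣-closed (divides c ≡.refl) Pa = *-closed c Pa

    gcd-closed : ∀ {m n} → P m → P n → P (gcd m n)
    gcd-closed {m} {n} Pm Pn with Bézout.identity (gcd-GCD m n)
    ... | Bézout.+- x y eq = ∸-closed _ (y * n) (≡.subst P (≡.sym eq) (*-closed x Pm)) (*-closed y Pn)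
    ... | Bézout.-+ x y eq = ∸-closed _ (x * m) (≡.subst P (≡.sym eq) (*-closed y Pn)) (*-closed x Pm)

  gcd[∣m-n∣,o]<o : ∀ {m n o} → m ≢ n → m < o → n < o → gcd ∣ m - n ∣ o < o
  gcd[∣m-n∣,o]<o {m} {n} {o} m≢n m<o n<o =
    ≤-<-trans (∣⇒≤ {{ℕ.≢-nonZero (m≢n ∘ ∣m-n∣≡0⇒m≡n)}} (gcd[m,n]∣m ∣ m - n ∣ o))
              (≤-<-trans (∣m-n∣≤m⊔n m n) (⊔-lub m<o n<o))

  [1+m]^[1+e]≡1+[1+t]*m : ∀ m e → ∃[ t ] (suc m ^ suc e ≡ suc (suc t * m))
  [1+m]^[1+e]≡1+[1+t]*m m zero    = 0 , ≡.cong suc (≡.trans (*-identityʳ m) (≡.sym (+-identityʳ m)))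
  [1+m]^[1+e]≡1+[1+t]*m m (suc e) with t , eq ← [1+m]^[1+e]≡1+[1+t]*m m e =
    suc m * suc t , ≡.trans (≡.cong (suc m *_) eq) (step m t)
    where
    open import Data.Nat.Tactic.RingSolver using (solve-∀)
    step : ∀ m t → suc m * suc (suc t * m) ≡ suc (suc (suc m * suc t) * m)
    step = solve-∀

  ^-cancelˡ-≤ : ∀ {m a b} → 1 < m → m ^ a ≤ m ^ b → a ≤ b
  ^-cancelˡ-≤ {m} 1<m mᵃ≤mᵇ = ≮⇒≥ (λ b<a → <⇒≱ (^-monoʳ-< m 1<m b<a) mᵃ≤mᵇ)

  m≤o∸n⇒n≤o∸m : ∀ {m n o} → n ≤ o → m ≤ o ∸ n → n ≤ o ∸ m
  m≤o∸n⇒n≤o∸m {m} {n} n≤o m≤o∸n =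
    m+n≤o⇒m≤o∸n n (≤-trans (≤-reflexive (+-comm n m)) (m≤o∸n⇒m+n≤o m n≤o m≤o∸n))

module FieldTheory {c ℓ} (L : FiniteField c ℓ) where

  open FiniteField L hiding (_^_)
  open Counting
  open UniqueLists setoid
  open Arithmetic using (prime∣C)
  open import Data.Nat.Divisibility using (_∣_; divides)
  open import Data.Nat.Primality using (Prime)
  open import Data.Nat.Combinatorics using (_C_; nCn≡1)
  open import Data.Fin.Properties using (toℕ<n; toℕ-inject₁; toℕ-fromℕ)
  open import Data.Vec using (Vec; []; _∷_; _++_; replicate)
  open import Data.Vec.Functional using (tail; init)
  open import Data.List.Properties using (length-map; length-deduplicate)
  open import Data.List.Relation.Unary.All.Properties using (¬Any⇒All¬)
  open import Data.List.Membership.Setoid setoid using (_∈_)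
  open import Data.List.Membership.Setoid.Properties
    using (∈-map⁺; ∈-map⁻; ∈-deduplicate⁺; ∈-deduplicate⁻; ∈-filter⁺; ∈-filter⁻)
  import Data.List.Relation.Unary.Unique.Setoid.Properties as Unique
  open import Data.List.Relation.Unary.Unique.DecSetoid.Properties using (deduplicate-!)
  open import Data.List.Relation.Binary.Permutation.Setoid setoid using (_↭_)
  open import Data.List.Relation.Binary.Permutation.Setoid.Properties setoid using (foldr-commMonoid)
  open import Algebra.Properties.Ring ring
  open import Algebra.Properties.Semiring.Exp semiring
  open import Algebra.Properties.Semiring.Mult semiring
  open import Algebra.Properties.Monoid.Sum +-monoid using (sum; sum-init-last; sum-cong-≋; sum-replicate-zero)
  import Algebra.Properties.CommutativeSemiring.Binomial commutativeSemiring as Binomial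
  open import Algebra.Solver.Ring.NaturalCoefficients.Default commutativeSemiring
    using (solve; _:+_; _:*_; _:=_; con)
  module ≈-Reasoning = Relation.Binary.Reasoning.Setoid setoid

  x*y≈0⇒x≈0∨y≈0 : ∀ {x y} → x * y ≈ 0# → x ≈ 0# ⊎ y ≈ 0#
  x*y≈0⇒x≈0∨y≈0 {x} {y} xy≈0 with x ≟ 0#
  ... | yes x≈0 = inj₁ x≈0
  ... | no x≉0 with x⁻¹ , xx⁻¹≈1 ← inverse x x≉0 = inj₂ (begin
    y              ≈⟨ *-identityˡ y ⟨
    1# * y         ≈⟨ *-congʳ xx⁻¹≈1 ⟨
    x * x⁻¹ * y    ≈⟨ solve 3 (λ x x⁻¹ y → x :* x⁻¹ :* y := x⁻¹ :* (x :* y)) refl x x⁻¹ y ⟩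
    x⁻¹ * (x * y)  ≈⟨ *-congˡ xy≈0 ⟩
    x⁻¹ * 0#       ≈⟨ zeroʳ x⁻¹ ⟩
    0#             ∎)
    where open ≈-Reasoning

  x≉0∧y≉0⇒x*y≉0 : ∀ {x y} → ¬ x ≈ 0# → ¬ y ≈ 0# → ¬ x * y ≈ 0#
  x≉0∧y≉0⇒x*y≉0 x≉0 y≉0 = [ x≉0 , y≉0 ]′ ∘ x*y≈0⇒x≈0∨y≈0

  x*z≈y*z⇒x≈y∨z≈0 : ∀ {x y z} → x * z ≈ y * z → x ≈ y ⊎ z ≈ 0#
  x*z≈y*z⇒x≈y∨z≈0 {x} {y} {z} xz≈yz
    with x*y≈0⇒x≈0∨y≈0 (trans ([y-z]x≈yx-zx z x y) (x≈y⇒x∙y⁻¹≈ε xz≈yz))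
  ... | inj₁ x-y≈0 = inj₁ (x∙y⁻¹≈ε⇒x≈y x y x-y≈0)
  ... | inj₂ z≈0   = inj₂ z≈0

  *-cancelˡ-≉0 : ∀ {x y z} → ¬ x ≈ 0# → x * y ≈ x * z → y ≈ z
  *-cancelˡ-≉0 {x} {y} {z} x≉0 xy≈xz =
    [ id , ⊥-elim ∘ x≉0 ]′ (x*z≈y*z⇒x≈y∨z≈0 (trans (*-comm y x) (trans xy≈xz (*-comm x z))))

  x^n≈0⇒x≈0 : ∀ {x} n → x ^ n ≈ 0# → x ≈ 0#
  x^n≈0⇒x≈0 zero    1≈0   = ⊥-elim (1≉0 1≈0)
  x^n≈0⇒x≈0 (suc n) xxⁿ≈0 = [ id , x^n≈0⇒x≈0 n ]′ (x*y≈0⇒x≈0∨y≈0 xxⁿ≈0)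

  -- Additive maps and rank-nullity

  record IsAdditive (f : Carrier → Carrier) : Set (c ⊔ ℓ) where
    field
      cong : ∀ {x y} → x ≈ y → f x ≈ f y
      homo : ∀ x y → f (x + y) ≈ f x + f y

    0-homo : f 0# ≈ 0#
    0-homo = x+x≈x⇒x≈0 (f 0#) (sym (trans (cong (sym (+-identityʳ 0#))) (homo 0# 0#)))

    -‿homo : ∀ x → f (- x) ≈ - f x
    -‿homo x = +-inverseˡ-unique (f (- x)) (f x)
      (trans (sym (homo (- x) x)) (trans (cong (-‿inverseˡ x)) 0-homo))

    sub-homo : ∀ x y → f (x - y) ≈ f x - f y
    sub-homo x y = trans (homo x (- y)) (+-congˡ (-‿homo y))

    kernel-trivial⇒injective : (∀ {x} → f x ≈ 0# → x ≈ 0#) → ∀ {x y} → f x ≈ f y → x ≈ y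
    kernel-trivial⇒injective ker≈0 {x} {y} fx≈fy =
      x∙y⁻¹≈ε⇒x≈y x y (ker≈0 (trans (sub-homo x y) (x≈y⇒x∙y⁻¹≈ε fx≈fy)))

  open IsAdditive

  isAdditive-resp : ∀ {f g} → (∀ x → f x ≈ g x) → IsAdditive f → IsAdditive g
  isAdditive-resp {f} {g} f≈g f-additive = record
    { cong = λ {x} {y} x≈y → trans (sym (f≈g x)) (trans (cong f-additive x≈y) (f≈g y))
    ; homo = λ x y → trans (sym (f≈g (x + y))) (trans (homo f-additive x y) (+-cong (f≈g x) (f≈g y)))
    }

  ∘-isAdditive : ∀ {f g} → IsAdditive f → IsAdditive g → IsAdditive (f ∘ g)
  ∘-isAdditive {f} {g} f-additive g-additive = record
    { cong = cong f-additive ∘ cong g-additive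
    ; homo = λ x y → trans (cong f-additive (homo g-additive x y)) (homo f-additive (g x) (g y))
    }

  sub-isAdditive : ∀ {f g} → IsAdditive f → IsAdditive g → IsAdditive (λ x → f x - g x)
  sub-isAdditive {f} {g} f-additive g-additive = record
    { cong = λ x≈y → +-cong (cong f-additive x≈y) (-‿cong (cong g-additive x≈y))
    ; homo = λ x y → begin
        f (x + y) - g (x + y)          ≈⟨ +-cong (homo f-additive x y) (-‿cong (homo g-additive x y)) ⟩
        (f x + f y) - (g x + g y)      ≈⟨ +-congˡ (-‿+-comm (g x) (g y)) ⟨
        (f x + f y) + (- g x + - g y)  ≈⟨ solve 4 (λ a b c d → (a :+ b) :+ (c :+ d) := (a :+ c) :+ (b :+ d))
                                                 refl (f x) (f y) (- g x) (- g y) ⟩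
        (f x - g x) + (f y - g y)      ∎
    }
    where open ≈-Reasoning

  translation-↭ : ∀ a → map (_+ a) elems ↭ elems
  translation-↭ a = map-↭ (_+ a) unique +-congʳ (+-cancelʳ a _ _)
    (λ {x} _ → complete (x + a))
    (λ {y} _ → y - a , complete (y - a) , trans (+-assoc y (- a) a) (trans (+-congˡ (-‿inverseˡ a)) (+-identityʳ y)))

  decSetoid : DecSetoid c ℓ
  decSetoid = record { isDecEquivalence = record { isEquivalence = isEquivalence ; _≟_ = _≟_ } }

  module _ {f} (f-additive : IsAdditive f) where

    kernelSize : ℕ
    kernelSize = count (λ x → f x ≟ 0#) elems

    fibreSize : ∀ {y x₀} → y ≈ f x₀ → count (λ x → f x ≟ y) elems ≡ kernelSize
    fibreSize {y} {x₀} y≈fx₀ = begin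
      count (λ x → f x ≟ y) elems               ≡⟨ ∑-↭ 𝟙-resp (translation-↭ x₀) ⟨
      count (λ x → f x ≟ y) (map (_+ x₀) elems) ≡⟨ ∑-map (_+ x₀) (λ x → 𝟙 (f x ≟ y)) elems ⟩
      count (λ x → f (x + x₀) ≟ y) elems        ≡⟨ count-≐ (λ x → f (x + x₀) ≟ y) (λ x → f x ≟ 0#)
                                                             ⇒ker ker⇒ elems ⟩
      kernelSize                                ∎
      where
      open ≡.≡-Reasoning
      𝟙-resp : ∀ {x x′} → x ≈ x′ → 𝟙 (f x ≟ y) ≡ 𝟙 (f x′ ≟ y)
      𝟙-resp x≈x′ = 𝟙-cong (trans (cong f-additive (sym x≈x′))) (trans (cong f-additive x≈x′)) _ _
      ⇒ker : ∀ {x} → f (x + x₀) ≈ y → f x ≈ 0#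
      ⇒ker {x} f[x+x₀]≈y = +-identityʳ-unique (f x₀) (f x)
        (trans (+-comm (f x₀) (f x)) (trans (sym (homo f-additive x x₀)) (trans f[x+x₀]≈y y≈fx₀)))
      ker⇒ : ∀ {x} → f x ≈ 0# → f (x + x₀) ≈ y
      ker⇒ {x} fx≈0 =
        trans (homo f-additive x x₀) (trans (+-congʳ fx≈0) (trans (+-identityˡ (f x₀)) (sym y≈fx₀)))

    -- Double counting: every x lies in exactly one fibre, and every fibre is a translate of the kernel.
    card≡imageSize*kernelSize : card ≡ imageSize f ℕ.* kernelSize
    card≡imageSize*kernelSize = begin
      card                                         ≡⟨ ℕ.*-identityʳ card ⟨
      card ℕ.* 1                                   ≡⟨ ∑-const 1 elems ⟨
      ∑ elems (λ _ → 1)                            ≡⟨ ∑-cong elems (All.universal (≡.sym ∘ count-fibres) elems) ⟩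
      ∑ elems (λ x → count (f x ≟_) image)         ≡⟨ ∑-comm (λ x y → 𝟙 (f x ≟ y)) elems image ⟩
      ∑ image (λ y → count (λ x → f x ≟ y) elems)  ≡⟨ ∑-cong image (All.tabulateₛ setoid fibreSize-image) ⟩
      ∑ image (λ _ → kernelSize)                   ≡⟨ ∑-const kernelSize image ⟩
      imageSize f ℕ.* kernelSize                   ∎
      where
      open ≡.≡-Reasoning
      image : List Carrier
      image = deduplicate _≟_ (map f elems)
      count-fibres : ∀ x → count (f x ≟_) image ≡ 1
      count-fibres x = count-unique _≟_ (deduplicate-! decSetoid (map f elems))
        (∈-deduplicate⁺ setoid _≟_ (λ y≈z x≈y → trans x≈y (sym y≈z))
                        (∈-map⁺ setoid setoid (cong f-additive) (complete x)))
      fibreSize-image : ∀ {y} → y ∈ image → count (λ x → f x ≟ y) elems ≡ kernelSize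
      fibreSize-image y∈image
        with x₀ , _ , y≈fx₀ ← ∈-map⁻ setoid setoid (∈-deduplicate⁻ setoid _≟_ (map f elems) y∈image) =
        fibreSize y≈fx₀

  -- Characteristic, Frobenius and Fermat

  sumᶠ : List Carrier → Carrier
  sumᶠ = foldr _+_ 0#

  productᶠ : List Carrier → Carrier
  productᶠ = foldr _*_ 1#

  sumᶠ-map-+ : ∀ a xs → sumᶠ (map (_+ a) xs) ≈ sumᶠ xs + length xs × a
  sumᶠ-map-+ a []       = sym (+-identityʳ 0#)
  sumᶠ-map-+ a (x ∷ xs) = trans (+-congˡ (sumᶠ-map-+ a xs))
    (solve 4 (λ x a s t → (x :+ a) :+ (s :+ t) := (x :+ s) :+ (a :+ t)) refl x a (sumᶠ xs) (length xs × a))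

  card×a≈0 : ∀ a → card × a ≈ 0#
  card×a≈0 a = +-identityʳ-unique (sumᶠ elems) (card × a)
    (trans (sym (sumᶠ-map-+ a elems)) (foldr-commMonoid +-isCommutativeMonoid (translation-↭ a)))

  [m^e]×1≈[m×1]^e : ∀ m e → (m ℕ.^ e) × 1# ≈ (m × 1#) ^ e
  [m^e]×1≈[m×1]^e m zero    = +-identityʳ 1#
  [m^e]×1≈[m×1]^e m (suc e) = trans (×1-homo-* m (m ℕ.^ e)) (*-congˡ ([m^e]×1≈[m×1]^e m e))

  card≡p^e⇒p×1≈0 : ∀ {p} e → card ≡ p ℕ.^ e → p × 1# ≈ 0#
  card≡p^e⇒p×1≈0 {p} e card≡p^e = x^n≈0⇒x≈0 e (begin
    (p × 1#) ^ e   ≈⟨ [m^e]×1≈[m×1]^e p e ⟨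
    (p ℕ.^ e) × 1# ≡⟨ ≡.cong (_× 1#) card≡p^e ⟨
    card × 1#      ≈⟨ card×a≈0 1# ⟩
    0#             ∎)
    where open ≈-Reasoning

  p∣m⇒m×x≈0 : ∀ {p m} x → p × 1# ≈ 0# → p ∣ m → m × x ≈ 0#
  p∣m⇒m×x≈0 {p} x p×1≈0 (divides c ≡.refl) = begin
    (c ℕ.* p) × x          ≈⟨ ×-congʳ (c ℕ.* p) (*-identityˡ x) ⟨
    (c ℕ.* p) × (1# * x)   ≈⟨ ×-assoc-* (c ℕ.* p) 1# x ⟨
    (c ℕ.* p) × 1# * x     ≈⟨ *-congʳ (×1-homo-* c p) ⟩
    c × 1# * (p × 1#) * x  ≈⟨ *-congʳ (*-congˡ p×1≈0) ⟩
    c × 1# * 0# * x        ≈⟨ *-congʳ (zeroʳ (c × 1#)) ⟩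
    0# * x                 ≈⟨ zeroˡ x ⟩
    0#                     ∎
    where open ≈-Reasoning

  frobenius-isAdditive : ∀ {p} → Prime p → p × 1# ≈ 0# → IsAdditive (_^ p)
  frobenius-isAdditive {suc p′} p-prime p×1≈0 = record { cong = ^-congˡ p ; homo = homo′ }
    where
    p = suc p′
    homo′ : ∀ x y → (x + y) ^ p ≈ x ^ p + y ^ p
    homo′ x y = begin
      (x + y) ^ p                                      ≈⟨ Binomial.theorem p x y ⟩
      t Fin.zero + sum (tail t)                        ≈⟨ +-congˡ (sum-init-last (tail t)) ⟩
      t Fin.zero + (sum (init (tail t)) + t (fromℕ p)) ≈⟨ +-congˡ (+-congʳ middle≈0) ⟩
      t Fin.zero + (0# + t (fromℕ p))                  ≈⟨ +-cong first≈yᵖ (trans (+-identityˡ _) last≈xᵖ) ⟩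
      y ^ p + x ^ p                                    ≈⟨ +-comm (y ^ p) (x ^ p) ⟩
      x ^ p + y ^ p                                    ∎
      where
      open ≈-Reasoning
      t = Binomial.binomialTerm x y p
      first≈yᵖ : t Fin.zero ≈ y ^ p
      first≈yᵖ = trans (×-homo-1 _) (*-identityˡ _)
      last-term : ∀ j → j ≡ p → (p C j) × (x ^ j * y ^ (p ∸ j)) ≈ x ^ p
      last-term _ ≡.refl = begin
        (p C p) × (x ^ p * y ^ (p ∸ p)) ≡⟨ ≡.cong₂ (λ c e → c × (x ^ p * y ^ e))
                                                   (nCn≡1 p) (ℕ.n∸n≡0 p) ⟩
        1 × (x ^ p * 1#)                ≈⟨ ×-homo-1 _ ⟩
        x ^ p * 1#                      ≈⟨ *-identityʳ _ ⟩
        x ^ p                           ∎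
      last≈xᵖ : t (fromℕ p) ≈ x ^ p
      last≈xᵖ = last-term (toℕ (fromℕ p)) (toℕ-fromℕ p)
      inner<p′ : (k : Fin p′) → toℕ (inject₁ k) < p′
      inner<p′ k = ℕ.≤-<-trans (ℕ.≤-reflexive (toℕ-inject₁ k)) (toℕ<n k)
      middle≈0 : sum (init (tail t)) ≈ 0#
      middle≈0 = trans (sum-cong-≋ λ k → p∣m⇒m×x≈0 _ p×1≈0 (prime∣C p-prime (s≤s z≤n) (s≤s (inner<p′ k))))
                       (sum-replicate-zero p′)

  ^-isAdditive-pow : ∀ {m} → IsAdditive (_^ m) → ∀ e → IsAdditive (_^ (m ℕ.^ e))
  ^-isAdditive-pow ^m-additive zero    = record { cong = ^-congˡ 1 ; homo = distribʳ 1# }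
  ^-isAdditive-pow {m} ^m-additive (suc e) =
    isAdditive-resp (λ x → ^-assocʳ x m (m ℕ.^ e)) (∘-isAdditive (^-isAdditive-pow ^m-additive e) ^m-additive)

  nonzero? : ∀ x → Dec (¬ 0# ≈ x)
  nonzero? x = ¬? (0# ≟ x)

  units : List Carrier
  units = filter nonzero? elems

  card≡1+|units| : card ≡ suc (length units)
  card≡1+|units| = ≡.trans (≡.sym (count+count-¬≡length (0# ≟_) elems))
    (≡.cong₂ ℕ._+_ (count-unique _≟_ unique (complete 0#)) (count≡length-filter nonzero? elems))

  ≉0-resp : ∀ {y z} → y ≈ z → ¬ 0# ≈ y → ¬ 0# ≈ z
  ≉0-resp y≈z 0≉y 0≈z = 0≉y (trans 0≈z (sym y≈z))

  ∈units⇒≉0 : ∀ {y} → y ∈ units → ¬ y ≈ 0#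
  ∈units⇒≉0 y∈ y≈0 = proj₂ (∈-filter⁻ setoid nonzero? ≉0-resp {xs = elems} y∈) (sym y≈0)

  ≉0⇒∈units : ∀ {y} → ¬ y ≈ 0# → y ∈ units
  ≉0⇒∈units {y} y≉0 = ∈-filter⁺ setoid nonzero? ≉0-resp (complete y) (y≉0 ∘ sym)

  productᶠ-map-* : ∀ x xs → productᶠ (map (x *_) xs) ≈ x ^ length xs * productᶠ xs
  productᶠ-map-* x []       = sym (*-identityˡ 1#)
  productᶠ-map-* x (y ∷ xs) = trans (*-congˡ (productᶠ-map-* x xs))
    (solve 4 (λ x y a b → (x :* y) :* (a :* b) := (x :* a) :* (y :* b)) refl x y (x ^ length xs) (productᶠ xs))

  productᶠ-units≉0 : ¬ productᶠ units ≈ 0#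
  productᶠ-units≉0 = productᶠ≉0 units ∈units⇒≉0
    where
    productᶠ≉0 : ∀ ys → (∀ {y} → y ∈ ys → ¬ y ≈ 0#) → ¬ productᶠ ys ≈ 0#
    productᶠ≉0 []       _    = 1≉0
    productᶠ≉0 (y ∷ ys) ys≉0 = x≉0∧y≉0⇒x*y≉0 (ys≉0 (here refl)) (productᶠ≉0 ys (ys≉0 ∘ there))

  scaling-↭ : ∀ {x} → ¬ x ≈ 0# → map (x *_) units ↭ units
  scaling-↭ {x} x≉0 with x⁻¹ , xx⁻¹≈1 ← inverse x x≉0 =
    map-↭ (x *_) (Unique.filter⁺ setoid nonzero? unique) *-congˡ (*-cancelˡ-≉0 x≉0)
      (λ y∈ → ≉0⇒∈units (x≉0∧y≉0⇒x*y≉0 x≉0 (∈units⇒≉0 y∈)))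
      (λ {y} y∈ → x⁻¹ * y , ≉0⇒∈units (x≉0∧y≉0⇒x*y≉0 x⁻¹≉0 (∈units⇒≉0 y∈)) ,
                  trans (sym (*-assoc x x⁻¹ y)) (trans (*-congʳ xx⁻¹≈1) (*-identityˡ y)))
    where
    x⁻¹≉0 : ¬ x⁻¹ ≈ 0#
    x⁻¹≉0 x⁻¹≈0 = 1≉0 (trans (sym xx⁻¹≈1) (trans (*-congˡ x⁻¹≈0) (zeroʳ x)))

  x^|units|≈1 : ∀ {x} → ¬ x ≈ 0# → x ^ length units ≈ 1#
  x^|units|≈1 {x} x≉0 = *-cancelˡ-≉0 productᶠ-units≉0 (begin
    productᶠ units * x ^ length units  ≈⟨ *-comm _ _ ⟩
    x ^ length units * productᶠ units  ≈⟨ productᶠ-map-* x units ⟨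
    productᶠ (map (x *_) units)        ≈⟨ foldr-commMonoid *-isCommutativeMonoid (scaling-↭ x≉0) ⟩
    productᶠ units                     ≈⟨ *-identityʳ _ ⟨
    productᶠ units * 1#                ∎)
    where open ≈-Reasoning

  x^card≈x : ∀ x → x ^ card ≈ x
  x^card≈x x with x ≟ 0#
  ... | yes x≈0 = trans (^-congʳ x card≡1+|units|) (trans (*-congʳ x≈0) (trans (zeroˡ _) (sym x≈0)))
  ... | no x≉0  = trans (^-congʳ x card≡1+|units|) (trans (*-congˡ (x^|units|≈1 x≉0)) (*-identityʳ x))

  -- Roots of polynomials

  -- A vector c₀ … c_(m-1) stands for the monic polynomial c₀ + c₁X + … + c_(m-1)X^(m-1) + X^m.
  monic : ∀ {m} → Vec Carrier m → Carrier → Carrier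
  monic []       x = 1#
  monic (c ∷ cs) x = c + x * monic cs x

  quotient : ∀ {m} → Vec Carrier (suc m) → Carrier → Vec Carrier m
  quotient (c ∷ [])      a = []
  quotient (c ∷ c′ ∷ cs) a = monic (c′ ∷ cs) a ∷ quotient (c′ ∷ cs) a

  -- cs(X) - cs(a) = (X - a) · quotient cs a(X), with both sides moved so that no subtraction occurs.
  division : ∀ {m} (cs : Vec Carrier (suc m)) a x →
             monic cs x + a * monic (quotient cs a) x ≈ x * monic (quotient cs a) x + monic cs a
  division (c ∷ [])      a x =
    solve 3 (λ c a x → c :+ x :* con 1 :+ a :* con 1 := x :* con 1 :+ (c :+ a :* con 1)) refl c a x
  division (c ∷ c′ ∷ cs) a x = begin
    c + x * p + a * (r + x * q)   ≈⟨ solve 6 (λ c x p a r q → c :+ x :* p :+ a :* (r :+ x :* q)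
                                                         := c :+ a :* r :+ x :* (p :+ a :* q)) refl c x p a r q ⟩
    c + a * r + x * (p + a * q)   ≈⟨ +-congˡ (*-congˡ (division (c′ ∷ cs) a x)) ⟩
    c + a * r + x * (x * q + r)   ≈⟨ solve 5 (λ c x a r q → c :+ a :* r :+ x :* (x :* q :+ r)
                                                         := x :* (r :+ x :* q) :+ (c :+ a :* r)) refl c x a r q ⟩
    x * (r + x * q) + (c + a * r) ∎
    where
    open ≈-Reasoning
    p = monic (c′ ∷ cs) x
    q = monic (quotient (c′ ∷ cs) a) x
    r = monic (c′ ∷ cs) a

  root? : ∀ {m} (cs : Vec Carrier m) x → Dec (monic cs x ≈ 0#)
  root? cs x = monic cs x ≟ 0#

  roots≤degree : ∀ {m} (cs : Vec Carrier m) → count (root? cs) elems ≤ m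
  roots≤degree []          = ℕ.≤-reflexive (count-none (root? []) (All.universal (λ _ → 1≉0) elems))
  roots≤degree {suc m} cs with Any.any? (root? cs) elems
  ... | no no-root = ℕ.≤-trans (ℕ.≤-reflexive (count-none (root? cs) (¬Any⇒All¬ elems no-root))) z≤n
  ... | yes some-root with a , csa≈0 ← Any.satisfied some-root =
    ℕ.≤-trans (count-⊆-∪ (root? cs) (a ≟_) (root? (quotient cs a)) root⇒a∨root elems)
              (ℕ.+-mono-≤ (ℕ.≤-reflexive (count-unique _≟_ unique (complete a))) (roots≤degree (quotient cs a)))
    where
    root⇒a∨root : ∀ {x} → monic cs x ≈ 0# → a ≈ x ⊎ monic (quotient cs a) x ≈ 0#
    root⇒a∨root {x} csx≈0 = x*z≈y*z⇒x≈y∨z≈0 (begin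
      a * q               ≈⟨ +-identityˡ _ ⟨
      0# + a * q          ≈⟨ +-congʳ csx≈0 ⟨
      monic cs x + a * q  ≈⟨ division cs a x ⟩
      x * q + monic cs a  ≈⟨ +-congˡ csa≈0 ⟩
      x * q + 0#          ≈⟨ +-identityʳ _ ⟩
      x * q               ∎)
      where
      open ≈-Reasoning
      q = monic (quotient cs a) x

  monic-zeros : ∀ r x → monic (replicate r 0#) x ≈ x ^ r
  monic-zeros zero    x = refl
  monic-zeros (suc r) x = trans (+-identityˡ _) (*-congˡ (monic-zeros r x))

  monic-zeros++ : ∀ r {m} (cs : Vec Carrier m) x → monic (replicate r 0# ++ cs) x ≈ x ^ r * monic cs x
  monic-zeros++ zero    cs x = sym (*-identityˡ _)
  monic-zeros++ (suc r) cs x =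
    trans (+-identityˡ _) (trans (*-congˡ (monic-zeros++ r cs x)) (sym (*-assoc x (x ^ r) (monic cs x))))

  fixedBy? : ∀ Q x → Dec (x ^ Q ≈ x)
  fixedBy? Q x = (x ^ Q) ≟ x

  module _ (r : ℕ) where

    private
      M = suc r
      Q = suc M

    X^Q-X : Vec Carrier Q
    X^Q-X = 0# ∷ - 1# ∷ replicate r 0#

    fixed⇒root : ∀ {x} → x ^ Q ≈ x → monic X^Q-X x ≈ 0#
    fixed⇒root {x} xᵠ≈x = begin
      0# + x * (- 1# + x * monic (replicate r 0#) x) ≈⟨ +-identityˡ _ ⟩
      x * (- 1# + x * monic (replicate r 0#) x)      ≈⟨ *-congˡ (+-congˡ (*-congˡ (monic-zeros r x))) ⟩
      x * (- 1# + x ^ M)                             ≈⟨ distribˡ x (- 1#) (x ^ M) ⟩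
      x * - 1# + x ^ Q                               ≈⟨ +-cong x*-1≈-x xᵠ≈x ⟩
      - x + x                                        ≈⟨ -‿inverseˡ x ⟩
      0#                                             ∎
      where
      open ≈-Reasoning
      x*-1≈-x : x * - 1# ≈ - x
      x*-1≈-x = trans (sym (-‿distribʳ-* x 1#)) (-‿cong (*-identityʳ x))

    count-fixedBy≤Q : count (fixedBy? Q) elems ≤ Q
    count-fixedBy≤Q = ℕ.≤-trans (count-⊆ (fixedBy? Q) (root? X^Q-X) fixed⇒root elems) (roots≤degree X^Q-X)

    -- geometric t is 1 + X^M + X^(2M) + … + X^(tM).
    geometric : ∀ t → Vec Carrier (t ℕ.* M)
    geometric zero    = []
    geometric (suc t) = (1# ∷ replicate r 0#) ++ geometric t

    geometric-sum : ∀ t x → monic (geometric t) x * x ^ M + 1# ≈ monic (geometric t) x + x ^ (suc t ℕ.* M)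
    geometric-sum zero    x =
      trans (+-congʳ (*-identityˡ _)) (trans (+-comm _ _) (+-congˡ (^-congʳ x (≡.sym (ℕ.+-identityʳ M)))))
    geometric-sum (suc t) x = begin
      g′ * y + 1#                   ≈⟨ +-congʳ (*-congʳ g′≈1+yg) ⟩
      (1# + y * g) * y + 1#         ≈⟨ solve 2 (λ y g → (con 1 :+ y :* g) :* y :+ con 1
                                                    := y :* (g :* y :+ con 1) :+ con 1) refl y g ⟩
      y * (g * y + 1#) + 1#         ≈⟨ +-congʳ (*-congˡ (geometric-sum t x)) ⟩
      y * (g + z) + 1#              ≈⟨ solve 3 (λ y g z → y :* (g :+ z) :+ con 1
                                                    := (con 1 :+ y :* g) :+ y :* z) refl y g z ⟩
      (1# + y * g) + y * z          ≈⟨ +-cong (sym g′≈1+yg) (sym (^-homo-* x M (suc t ℕ.* M))) ⟩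
      g′ + x ^ (suc (suc t) ℕ.* M)  ∎
      where
      open ≈-Reasoning
      y = x ^ M
      g = monic (geometric t) x
      g′ = monic (geometric (suc t)) x
      z = x ^ (suc t ℕ.* M)
      g′≈1+yg : g′ ≈ 1# + y * g
      g′≈1+yg = +-congˡ (trans (*-congˡ (monic-zeros++ r (geometric t) x)) (sym (*-assoc x (x ^ r) g)))

    module _ (t : ℕ) (card≡1+[1+t]M : card ≡ suc (suc t ℕ.* M)) where

      -- A non-fixed x is nonzero, so Fermat gives y^(t+1) = 1 for y = x^M ≠ 1,
      -- and the geometric sum kills the factor y - 1.
      nonfixed⇒geometric-root : ∀ {x} → ¬ x ^ Q ≈ x → monic (geometric t) x ≈ 0#
      nonfixed⇒geometric-root {x} xᵠ≉x =
        [ (λ y≈1 → ⊥-elim (xᵠ≉x (trans (*-congˡ y≈1) (*-identityʳ x)))) , id ]′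
          (x*z≈y*z⇒x≈y∨z≈0 yg≈1g)
        where
        open ≈-Reasoning
        g = monic (geometric t) x
        x≉0 : ¬ x ≈ 0#
        x≉0 x≈0 = xᵠ≉x (trans (^-congˡ Q x≈0) (trans (zeroˡ _) (sym x≈0)))
        x^[1+t]M≈1 : x ^ (suc t ℕ.* M) ≈ 1#
        x^[1+t]M≈1 = *-cancelˡ-≉0 x≉0 (begin
          x * x ^ (suc t ℕ.* M)  ≈⟨ ^-congʳ x (≡.sym card≡1+[1+t]M) ⟩
          x ^ card               ≈⟨ x^card≈x x ⟩
          x                      ≈⟨ *-identityʳ x ⟨
          x * 1#                 ∎)
        yg≈1g : x ^ M * g ≈ 1# * g
        yg≈1g = +-cancelʳ 1# _ _ (begin
          x ^ M * g + 1#         ≈⟨ +-congʳ (*-comm _ _) ⟩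
          g * x ^ M + 1#         ≈⟨ geometric-sum t x ⟩
          g + x ^ (suc t ℕ.* M)  ≈⟨ +-congˡ x^[1+t]M≈1 ⟩
          g + 1#                 ≈⟨ +-congʳ (*-identityˡ g) ⟨
          1# * g + 1#            ∎)

      Q≤count-fixedBy : Q ≤ count (fixedBy? Q) elems
      Q≤count-fixedBy = ℕ.+-cancelʳ-≤ (t ℕ.* M) Q #fixed (begin
        Q ℕ.+ t ℕ.* M               ≡⟨ card≡1+[1+t]M ⟨
        card                        ≡⟨ count-all (λ _ → yes tt) (All.universal _ elems) ⟨
        count (λ _ → yes tt) elems  ≤⟨ count-⊆-∪ (λ _ → yes tt) (fixedBy? Q) (root? G) fixed∨root elems ⟩
        #fixed ℕ.+ #roots           ≤⟨ ℕ.+-monoʳ-≤ #fixed (roots≤degree G) ⟩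
        #fixed ℕ.+ t ℕ.* M          ∎)
        where
        open ℕ.≤-Reasoning
        G = geometric t
        #fixed = count (fixedBy? Q) elems
        #roots = count (root? G) elems
        fixed∨root : ∀ {x} → ⊤ → x ^ Q ≈ x ⊎ monic G x ≈ 0#
        fixed∨root {x} _ with fixedBy? Q x
        ... | yes xᵠ≈x = inj₁ xᵠ≈x
        ... | no xᵠ≉x  = inj₂ (nonfixed⇒geometric-root xᵠ≉x)

      count-fixedBy : count (fixedBy? Q) elems ≡ Q
      count-fixedBy = ℕ.≤-antisym count-fixedBy≤Q Q≤count-fixedBy

  -- The code C_T

  δ : ∀ {k} → Fin k → Fin k → Carrier
  δ Fin.zero    Fin.zero    = 1#
  δ Fin.zero    (Fin.suc _) = 0#
  δ (Fin.suc _) Fin.zero    = 0#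
  δ (Fin.suc i) (Fin.suc l) = δ i l

  sumFin-0* : ∀ k (g : Fin k → Carrier) → sumFin k (λ l → 0# * g l) ≈ 0#
  sumFin-0* zero    g = refl
  sumFin-0* (suc k) g = trans (+-cong (zeroˡ _) (sumFin-0* k (g ∘ Fin.suc))) (+-identityʳ 0#)

  sumFin-δ : ∀ k (i : Fin k) (g : Fin k → Carrier) → sumFin k (λ l → δ i l * g l) ≈ g i
  sumFin-δ (suc k) Fin.zero    g = trans (+-cong (*-identityˡ _) (sumFin-0* k (g ∘ Fin.suc))) (+-identityʳ _)
  sumFin-δ (suc k) (Fin.suc i) g = trans (+-cong (zeroˡ _) (sumFin-δ k i (g ∘ Fin.suc))) (+-identityˡ _)

  ^ᴸ≈^ : ∀ x n → FiniteField._^_ L x n ≈ x ^ n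
  ^ᴸ≈^ x zero    = refl
  ^ᴸ≈^ x (suc n) = *-congˡ (^ᴸ≈^ x n)

  qPoly-δ : ∀ q {k} (t : Fin k → ℕ) i x → qPoly q t (δ i) x ≈ x ^ (q ℕ.^ t i)
  qPoly-δ q {k} t i x = trans (sumFin-δ k i _) (^ᴸ≈^ x (q ℕ.^ t i))

  length-allCoeffs : ∀ k → length (allCoeffs k) ≡ card ℕ.^ k
  length-allCoeffs zero    = ≡.refl
  length-allCoeffs (suc k) = ≡.trans (length-concatMap-const (λ _ → length-map _ (allCoeffs k)) elems)
                                     (≡.cong (card ℕ.*_) (length-allCoeffs k))

  codeSize≤card^k : ∀ q {k} (t : Fin k → ℕ) → codeSize q t ≤ card ℕ.^ k
  codeSize≤card^k q {k} t = ℕ.≤-trans (length-deduplicate _ (map (λ a → table (qPoly q t a)) (allCoeffs k)))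
    (ℕ.≤-reflexive (≡.trans (length-map _ (allCoeffs k)) (length-allCoeffs k)))

open import Data.Nat.Primality using (Prime)

module Frobenius {c ℓ} (L : FiniteField c ℓ) {p m q n : ℕ} (p-prime : Prime p)
                 (q≡p^[1+m] : q ≡ p ℕ.^ suc m) (card≡q^n : FiniteField.card L ≡ q ℕ.^ n) where

  open FiniteField L hiding (_^_)
  open FieldTheory L
  open IsAdditive
  open Counting using (count; count-≐; count-all)
  open Arithmetic using (gcd-closed; ∣-closed; [1+m]^[1+e]≡1+[1+t]*m)
  open import Data.Nat.Divisibility using (_∣_; divides)
  open import Data.Nat.GCD using (gcd; gcd[m,n]∣m; gcd[m,n]∣n; gcd[m,n]≢0)
  open import Data.Nat.Primality using (prime⇒nonTrivial)
  open import Function.Properties.Equivalence using () renaming (trans to ⇔-trans)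
  open import Algebra.Properties.Ring ring using (x∙y⁻¹≈ε⇒x≈y; x≈y⇒x∙y⁻¹≈ε)
  open import Algebra.Properties.Semiring.Exp semiring using (_^_; ^-congˡ; ^-congʳ; ^-assocʳ)

  1<q : 1 < q
  1<q = ≡.subst (1 <_) (≡.sym q≡p^[1+m])
          (ℕ.^-monoʳ-< p (ℕ.nonTrivial⇒n>1 p {{prime⇒nonTrivial p-prime}}) {0} {suc m} (s≤s z≤n))

  ^q^e-isAdditive : ∀ e → IsAdditive (_^ (q ℕ.^ e))
  ^q^e-isAdditive e = ≡.subst (λ q → IsAdditive (_^ (q ℕ.^ e))) (≡.sym q≡p^[1+m])
    (^-isAdditive-pow (^-isAdditive-pow {p} ^p-isAdditive (suc m)) e)
    where
    card≡p^[[1+m]n] : card ≡ p ℕ.^ (suc m ℕ.* n)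
    card≡p^[[1+m]n] = ≡.trans card≡q^n (≡.trans (≡.cong (ℕ._^ n) q≡p^[1+m]) (ℕ.^-*-assoc p (suc m) n))
    ^p-isAdditive = frobenius-isAdditive p-prime (card≡p^e⇒p×1≈0 (suc m ℕ.* n) card≡p^[[1+m]n])

  ^q^e-injective : ∀ e {x y} → x ^ (q ℕ.^ e) ≈ y ^ (q ℕ.^ e) → x ≈ y
  ^q^e-injective e = kernel-trivial⇒injective (^q^e-isAdditive e) (x^n≈0⇒x≈0 (q ℕ.^ e))

  ^q^[a+b] : ∀ a b x → x ^ (q ℕ.^ (a ℕ.+ b)) ≈ (x ^ (q ℕ.^ a)) ^ (q ℕ.^ b)
  ^q^[a+b] a b x = trans (^-congʳ x (ℕ.^-distribˡ-+-* q a b)) (sym (^-assocʳ x (q ℕ.^ a) (q ℕ.^ b)))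

  Fixed : ℕ → Carrier → Set ℓ
  Fixed e x = x ^ (q ℕ.^ e) ≈ x

  fixed-+ : ∀ {x} a b → Fixed a x → Fixed b x → Fixed (a ℕ.+ b) x
  fixed-+ {x} a b fixed-a fixed-b = trans (^q^[a+b] a b x) (trans (^-congˡ (q ℕ.^ b) fixed-a) fixed-b)

  fixed-∸ : ∀ {x} a b → Fixed (a ℕ.+ b) x → Fixed b x → Fixed a x
  fixed-∸ {x} a b fixed-a+b fixed-b = ^q^e-injective b (trans (sym (^q^[a+b] a b x)) (trans fixed-a+b (sym fixed-b)))

  fixed-n : ∀ x → Fixed n x
  fixed-n x = trans (^-congʳ x (≡.sym card≡q^n)) (x^card≈x x)

  ^q^[d+a]≈^q^a⇔fixed : ∀ d a x → x ^ (q ℕ.^ (d ℕ.+ a)) ≈ x ^ (q ℕ.^ a) ⇔ Fixed d x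
  ^q^[d+a]≈^q^a⇔fixed d a x = mk⇔
    (λ eq → ^q^e-injective a (trans (sym (^q^[a+b] d a x)) eq))
    (λ fixed-d → trans (^q^[a+b] d a x) (^-congˡ (q ℕ.^ a) fixed-d))

  ^q^a≈^q^b⇔fixed-gcd : ∀ a b x → x ^ (q ℕ.^ a) ≈ x ^ (q ℕ.^ b) ⇔ Fixed (gcd ∣ a - b ∣ n) x
  ^q^a≈^q^b⇔fixed-gcd a b x = mk⇔
    (λ eq → gcd-closed (λ e → Fixed e x) fixed-+ fixed-∸ {∣ a - b ∣} {n} (to ⇔fixed-∣a-b∣ eq) (fixed-n x))
    (from ⇔fixed-∣a-b∣ ∘ ∣-closed (λ e → Fixed e x) fixed-+ fixed-∸ (gcd[m,n]∣m ∣ a - b ∣ n))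
    where
    open Equivalence
    ⇔fixed-∣a-b∣ : x ^ (q ℕ.^ a) ≈ x ^ (q ℕ.^ b) ⇔ Fixed ∣ a - b ∣ x
    ⇔fixed-∣a-b∣ with ℕ.≤-total a b
    ... | inj₁ a≤b = ≡.subst₂ (λ e s → x ^ (q ℕ.^ a) ≈ x ^ (q ℕ.^ e) ⇔ Fixed s x)
                       (ℕ.m∸n+n≡m a≤b) (≡.sym (ℕ.m≤n⇒∣m-n∣≡n∸m a≤b))
                       (⇔-trans (mk⇔ sym sym) (^q^[d+a]≈^q^a⇔fixed (b ∸ a) a x))
    ... | inj₂ b≤a = ≡.subst₂ (λ e s → x ^ (q ℕ.^ e) ≈ x ^ (q ℕ.^ b) ⇔ Fixed s x)
                       (ℕ.m∸n+n≡m b≤a) (≡.sym (ℕ.m≤n⇒∣n-m∣≡n∸m b≤a))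
                       (^q^[d+a]≈^q^a⇔fixed (a ∸ b) b x)

  count-fixed : ∀ {g} .{{_ : NonZero n}} → 0 < g → g ∣ n → count (fixedBy? (q ℕ.^ g)) elems ≡ q ℕ.^ g
  count-fixed {g} 0<g (divides e n≡eg) with q ℕ.^ g in q^g≡ | ℕ.^-monoʳ-< q 1<q 0<g
  ... | suc zero    | s≤s ()
  ... | suc (suc r) | _ with e
  ...   | zero   = ⊥-elim (ℕ.≢-nonZero⁻¹ n n≡eg)
  ...   | suc e′ with t , Q^[1+e′]≡ ← [1+m]^[1+e]≡1+[1+t]*m (suc r) e′ = count-fixedBy r t (begin
    card                    ≡⟨ card≡q^n ⟩
    q ℕ.^ n                 ≡⟨ ≡.cong (q ℕ.^_) (≡.trans n≡eg (ℕ.*-comm (suc e′) g)) ⟩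
    q ℕ.^ (g ℕ.* suc e′)    ≡⟨ ℕ.^-*-assoc q g (suc e′) ⟨
    (q ℕ.^ g) ℕ.^ suc e′    ≡⟨ ≡.cong (ℕ._^ suc e′) q^g≡ ⟩
    suc (suc r) ℕ.^ suc e′  ≡⟨ Q^[1+e′]≡ ⟩
    suc (suc t ℕ.* suc r)   ∎)
    where open ≡.≡-Reasoning

  module Codeword {k} (t : Fin k → ℕ) (i j : Fin k) where

    codeword : Carrier → Carrier
    codeword x = qPoly q t (δ i) x - qPoly q t (δ j) x

    g : ℕ
    g = gcd ∣ t i - t j ∣ n

    codeword-isAdditive : IsAdditive codeword
    codeword-isAdditive = isAdditive-resp (λ x → +-cong (sym (qPoly-δ q t i x)) (-‿cong (sym (qPoly-δ q t j x))))
                                          (sub-isAdditive (^q^e-isAdditive (t i)) (^q^e-isAdditive (t j)))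

    codeword≈0⇔fixed : ∀ x → codeword x ≈ 0# ⇔ Fixed g x
    codeword≈0⇔fixed x = mk⇔
      (λ codeword≈0 → to ⇔fixed-g
         (trans (sym (qPoly-δ q t i x)) (trans (x∙y⁻¹≈ε⇒x≈y _ _ codeword≈0) (qPoly-δ q t j x))))
      (λ fixed-g → x≈y⇒x∙y⁻¹≈ε
         (trans (qPoly-δ q t i x) (trans (from ⇔fixed-g fixed-g) (sym (qPoly-δ q t j x)))))
      where
      open Equivalence
      ⇔fixed-g = ^q^a≈^q^b⇔fixed-gcd (t i) (t j) x

    kernelSize≡q^g : .{{_ : NonZero n}} → kernelSize codeword-isAdditive ≡ q ℕ.^ g
    kernelSize≡q^g = ≡.trans (count-≐ (λ x → codeword x ≟ 0#) (fixedBy? (q ℕ.^ g))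
                                      (to (codeword≈0⇔fixed _)) (from (codeword≈0⇔fixed _)) elems)
                             (count-fixed 0<g (gcd[m,n]∣n ∣ t i - t j ∣ n))
      where
      open Equivalence
      0<g : 0 < g
      0<g = ℕ.n≢0⇒n>0 (gcd[m,n]≢0 ∣ t i - t j ∣ n (inj₂ (ℕ.≢-nonZero⁻¹ n)))

    codeword-rank : .{{_ : NonZero n}} → g ≤ n → HasRank q codeword (n ∸ g)
    codeword-rank g≤n = ℕ.*-cancelʳ-≡ (imageSize codeword) (q ℕ.^ (n ∸ g)) (q ℕ.^ g) {{q^g≢0}} (begin
      imageSize codeword ℕ.* q ℕ.^ g                        ≡⟨ ≡.cong (imageSize codeword ℕ.*_) kernelSize≡q^g ⟨
      imageSize codeword ℕ.* kernelSize codeword-isAdditive ≡⟨ card≡imageSize*kernelSize codeword-isAdditive ⟨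
      card                                                  ≡⟨ card≡q^n ⟩
      q ℕ.^ n                                               ≡⟨ ≡.cong (q ℕ.^_) (ℕ.m∸n+n≡m g≤n) ⟨
      q ℕ.^ (n ∸ g ℕ.+ g)                                   ≡⟨ ℕ.^-distribˡ-+-* q (n ∸ g) g ⟩
      q ℕ.^ (n ∸ g) ℕ.* q ℕ.^ g                             ∎)
      where
      open ≡.≡-Reasoning
      q^g≢0 : NonZero (q ℕ.^ g)
      q^g≢0 = ℕ.m^n≢0 q g {{ℕ.>-nonZero (ℕ.<-trans (s≤s z≤n) 1<q)}}

    codeword-nonzero : .{{_ : NonZero n}} → g < n → ¬ SameMap (qPoly q t (δ i)) (qPoly q t (δ j))
    codeword-nonzero g<n same = ℕ.<⇒≢ (ℕ.^-monoʳ-< q 1<q g<n) (begin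
      q ℕ.^ g                        ≡⟨ kernelSize≡q^g ⟨
      kernelSize codeword-isAdditive ≡⟨ count-all _ (All.universal (x≈y⇒x∙y⁻¹≈ε ∘ same) elems) ⟩
      card                           ≡⟨ card≡q^n ⟩
      q ℕ.^ n                        ∎)
      where open ≡.≡-Reasoning

open import Data.Nat using (_^_)
open import Data.Nat.GCD using (gcd)
open import Function.Definitions using (Injective)
open Arithmetic using (gcd[∣m-n∣,o]<o; ^-cancelˡ-≤; m≤o∸n⇒n≤o∸m)

proposition3p1 : ∀ {c ℓ} (q n k : ℕ) → IsPrimePower q → .{{NonZero n}} →
    (L : FiniteField c ℓ) → FiniteField.card L ≡ q ^ n →
    (t : Fin k → ℕ) → (∀ i → t i < n) → Injective _≡_ _≡_ t →
    FiniteField.IsMRD L q n t →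
    ∀ i j → ¬ i ≡ j → gcd ∣ t i - t j ∣ n < k
proposition3p1 q n k (p , m , p-prime , q≡p^[1+m]) L card≡q^n t t<n t-injective
               (d , (_ , d-minimal) , codeSize≡) i j i≢j = begin-strict
  g           ≤⟨ m≤o∸n⇒n≤o∸m (ℕ.<⇒≤ g<n) d≤n∸g ⟩
  n ∸ d       <⟨ ℕ.m<m+n (n ∸ d) (s≤s z≤n) ⟩
  n ∸ d ℕ.+ 1 ≤⟨ [n∸d]+1≤k ⟩
  k           ∎
  where
  open ℕ.≤-Reasoning
  open FieldTheory L using (δ; codeSize≤card^k)
  open Frobenius L {m = m} {n = n} p-prime q≡p^[1+m] card≡q^n
  open Codeword t i j

  g<n : g < n
  g<n = gcd[∣m-n∣,o]<o (i≢j ∘ t-injective) (t<n i) (t<n j)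

  d≤n∸g : d ≤ n ∸ g
  d≤n∸g = d-minimal (δ i) (δ j) (codeword-nonzero g<n) (n ∸ g) (codeword-rank (ℕ.<⇒≤ g<n))

  [n∸d]+1≤k : n ∸ d ℕ.+ 1 ≤ k
  [n∸d]+1≤k = ℕ.*-cancelˡ-≤ n (^-cancelˡ-≤ 1<q (begin
    q ^ (n ℕ.* (n ∸ d ℕ.+ 1)) ≡⟨ codeSize≡ ⟨
    FiniteField.codeSize L q t ≤⟨ codeSize≤card^k q t ⟩
    FiniteField.card L ^ k    ≡⟨ ≡.cong (_^ k) card≡q^n ⟩
    (q ^ n) ^ k               ≡⟨ ℕ.^-*-assoc q n k ⟩
    q ^ (n ℕ.* k)             ∎))
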